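{- Let $G=(V,E)$ be a graph, $B$ a $2$-branch of $G$ with umbrella ordering $\sigma_B$ such that $B^R\neq\emptyset$, and $x$ a vertex of $B^R$. Then for every inclusion-maximal $K$-join $B'$ of $G$ containing $x$, there exists an extremal edge $uv$ of $\sigma_B$ such that $B'=\{w\in B : u\le_{\sigma_B} w\le_{\sigma_B} v\}$.
   Context: A proper interval graph is a graph with an interval representation in which no interval strictly contains another. An umbrella ordering of a graph is an ordering $v_1,\dots,v_n$ such that whenever $v_iv_j$ is an edge with $i<j$, then $v_iv_l,v_lv_j$ are edges for all $i<l<j$. For an umbrella ordering $\sigma$, an edge $uv$ with $u<_\sigma v$ is extremal if there is no edge $u'v'\neq uv$ with $u'\le_\sigma u$ and $v\le_\sigma v'$. A $2$-branch of $G$ is a set $B\subseteq V$ such that $G[B]$ is a connected proper interval graph with umbrella ordering $\sigma_B=b_1,\dots,b_{|B|}$, and $V\setminus B$ can be partitioned into $L,R,C$ with: no edges between $B$ and $C$; every vertex of $L$ and of $R$ has a neighbor in $B$; letting $b_l$ be the neighbor of $b_{|B|}$ with minimal index and $b_{l'}$ the neighbor of $b_1$ with maximal index in $\sigma_B$, there are no edges between $\{b_1,\dots,b_{l-1}\}$ and $R$ and no edges between $\{b_{l'+1},\dots,b_{|B|}\}$ and $L$; $N_R(b_i)\subseteq N_R(b_{i+1})$ for $l\le i<|B|$ and $N_L(b_{i+1})\subseteq N_L(b_i)$ for $1\le i<l'$. With $B_1=\{b_1,\dots,b_{l'}\}$ and $B_2=\{b_l,\dots,b_{|B|}\}$, set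 $B^R=B\setminus(B_1\cup B_2)$. A $K$-join of $G$ is a set $B'\subseteq V$ inducing a clique, with an ordering $c_1,\dots,c_{|B'|}$, such that for every vertex $v\notin B'$ the set $N(v)\cap B'$ is empty, of the form $\{c_1,\dots,c_j\}$, or of the form $\{c_j,\dots,c_{|B'|}\}$. -}

module Defs where

open import Data.Nat using (ℕ; zero; suc; _<_; _≤_)
open import Data.Fin using (Fin; toℕ; fromℕ)
open import Data.Fin.Subset using (Subset; _∈_; _∉_; _⊆_)
open import Data.Bool using (Bool; true)
open import Data.Product using (Σ; ∃; ∃-syntax; _×_; _,_)
open import Data.Sum using (_⊎_)
open import Data.Rational using (ℚ) renaming (_≤_ to _≤ℚ_)
open import Relation.Nullary using (¬_)
open import Relation.Binary.PropositionalEquality using (_≡_; _≢_)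
open import Function.Bundles using (_⇔_)
open import Function.Definitions using (Injective)

record Graph : Set where
  field
    n     : ℕ
    adj   : Fin n → Fin n → Bool
    sym   : ∀ u v → adj u v ≡ adj v u
    irrefl : ∀ v → adj v v ≢ true

open Graph public

Vertex : Graph → Set
Vertex G = Fin (n G)

Adj : (G : Graph) → Vertex G → Vertex G → Set
Adj G u v = adj G u v ≡ true

data Reach (G : Graph) {k : ℕ} (b : Fin k → Vertex G) (i : Fin k) : Fin k → Set where
  here : Reach G b i i
  step : ∀ {j j'} → Reach G b i j → Adj G (b j) (b j') → Reach G b i j'

Connected : (G : Graph) {k : ℕ} → (Fin k → Vertex G) → Set
Connected G b = ∀ i j → Reach G b i j

IsProperIntervalInduced : (G : Graph) {k : ℕ} → (Fin k → Vertex G) → Set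
IsProperIntervalInduced G {k} b =
  Σ (Fin k → ℚ) λ lo → Σ (Fin k → ℚ) λ hi →
    (∀ i → lo i ≤ℚ hi i)
    × (∀ i j → i ≢ j → (Adj G (b i) (b j) ⇔ (lo i ≤ℚ hi j × lo j ≤ℚ hi i)))
    × (∀ i j → lo j ≤ℚ lo i → hi i ≤ℚ hi j → (lo i ≡ lo j × hi i ≡ hi j))

IsUmbrella : (G : Graph) {k : ℕ} → (Fin k → Vertex G) → Set
IsUmbrella G {k} b = ∀ (i j l : Fin k) → toℕ i < toℕ j → Adj G (b i) (b j) →
  toℕ i < toℕ l → toℕ l < toℕ j → Adj G (b i) (b l) × Adj G (b l) (b j)

IsExtremal : (G : Graph) {k : ℕ} → (Fin k → Vertex G) → Fin k → Fin k → Set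
IsExtremal G {k} b i j =
  toℕ i < toℕ j × Adj G (b i) (b j) ×
  (∀ (i' j' : Fin k) → toℕ i' < toℕ j' → Adj G (b i') (b j') →
     toℕ i' ≤ toℕ i → toℕ j ≤ toℕ j' → (i' ≡ i × j' ≡ j))

data Label : Set where
  inB inL inR inC : Label

-- B = {b 0, ..., b m} (so |B| = suc m), umbrella ordering σ_B = b.
-- Indices: b_1 = b 0 (first), b_{|B|} = b (fromℕ m) (last).
-- ll  plays the role of l  (b_l  = neighbour of b_{|B|} of minimal index),
-- ll' plays the role of l' (b_l' = neighbour of b_1 of maximal index);
-- the closed neighbourhood is used so that these exist also when |B| = 1.
record TwoBranch (G : Graph) (m : ℕ) (b : Fin (suc m) → Vertex G) : Set where
  field
    inj       : Injective _≡_ _≡_ b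
    proper    : IsProperIntervalInduced G b
    connected : Connected G b
    umbrella  : IsUmbrella G b
    lab       : Vertex G → Label
    labB      : ∀ v → (lab v ≡ inB) ⇔ (∃[ i ] b i ≡ v)
    noBC      : ∀ i v → lab v ≡ inC → ¬ Adj G (b i) v
    nbrL      : ∀ v → lab v ≡ inL → ∃[ i ] Adj G (b i) v
    nbrR      : ∀ v → lab v ≡ inR → ∃[ i ] Adj G (b i) v
    ll        : Fin (suc m)
    ll-nbr    : Adj G (b (fromℕ m)) (b ll) ⊎ ll ≡ fromℕ m
    ll-min    : ∀ i → Adj G (b (fromℕ m)) (b i) ⊎ i ≡ fromℕ m → toℕ ll ≤ toℕ i
    ll'       : Fin (suc m)
    ll'-nbr   : Adj G (b Fin.zero) (b ll') ⊎ ll' ≡ Fin.zero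
    ll'-max   : ∀ i → Adj G (b Fin.zero) (b i) ⊎ i ≡ Fin.zero → toℕ i ≤ toℕ ll'
    noR       : ∀ i v → toℕ i < toℕ ll → lab v ≡ inR → ¬ Adj G (b i) v
    noL       : ∀ i v → toℕ ll' < toℕ i → lab v ≡ inL → ¬ Adj G (b i) v
    nestR     : ∀ i j → toℕ j ≡ suc (toℕ i) → toℕ ll ≤ toℕ i →
                  ∀ v → lab v ≡ inR → Adj G (b i) v → Adj G (b j) v
    nestL     : ∀ i j → toℕ j ≡ suc (toℕ i) → toℕ j ≤ toℕ ll' →
                  ∀ v → lab v ≡ inL → Adj G (b j) v → Adj G (b i) v

  -- position i lies in B^R = B \ (B_1 ∪ B_2), B_1 = {b_1..b_l'}, B_2 = {b_l..b_|B|}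
  InBR : Fin (suc m) → Set
  InBR i = toℕ ll' < toℕ i × toℕ i < toℕ ll

open TwoBranch public

IsClique : (G : Graph) → Subset (n G) → Set
IsClique G S = ∀ u v → u ∈ S → v ∈ S → u ≢ v → Adj G u v

IsKJoin : (G : Graph) → Subset (n G) → Set
IsKJoin G S =
  IsClique G S ×
  Σ ℕ λ k → Σ (Fin k → Vertex G) λ c →
    Injective _≡_ _≡_ c
    × (∀ v → v ∈ S ⇔ (∃[ i ] c i ≡ v))
    × (∀ v → v ∉ S →
         (∀ i → ¬ Adj G v (c i))
         ⊎ (∃[ j ] ∀ i → Adj G v (c i) ⇔ toℕ i < j)
         ⊎ (∃[ j ] ∀ i → Adj G v (c i) ⇔ j ≤ toℕ i))

IsMaximalKJoin : (G : Graph) → Subset (n G) → Set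
IsMaximalKJoin G S = IsKJoin G S × (∀ S' → IsKJoin G S' → S ⊆ S' → S' ⊆ S)

-- Every neighbour of a vertex of B^R lies in B, so a K-join through such a
-- vertex is a clique inside B, spanning positions i ≤ q ≤ j of σ_B.  Conversely,
-- for every edge b_a b_e (a < e) the block {b_a, ..., b_e} is a K-join: it is a
-- clique by the umbrella property, and each outside vertex sees a prefix or a
-- suffix of it (vertices of L see an initial segment of B, vertices of R a final
-- one, vertices of B on either side see the block from the near end, and vertices
-- of C see nothing).  Maximality therefore forces the K-join to be the block of an
-- edge b_i b_j which no other edge b_a b_e with a ≤ i, j ≤ e encloses, i.e. of an
-- extremal edge; i < j because the vertex of B^R has a neighbour in B.
module Submission where

open import Defs
open import Data.Bool using (true) renaming (_≟_ to _≟ᵇ_)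
open import Data.Bool.Properties using (T-≡)
open import Data.Empty using (⊥-elim)
open import Data.Fin using (Fin; zero; suc; toℕ; fromℕ<) renaming (_≟_ to _≟ᶠ_)
open import Data.Fin.Properties using (toℕ-injective; toℕ<n; toℕ≤pred[n]; toℕ-fromℕ<; any?)
open import Data.Fin.Subset using (Subset; _∈_; _∉_; _⊆_)
open import Data.Fin.Subset.Properties using (_∈?_)
open import Data.Nat using (ℕ; zero; suc; _≤_; _<_; z≤n; s≤s; _+_; _∸_; _≤?_; _<?_)
open import Data.Nat.Properties
  using (≤-refl; ≤-trans; ≤-antisym; <⇒≤; <⇒≱; ≰⇒>; ≮⇒≥; ≤-pred; <-irrefl; <-cmp; ≤-<-trans; <-≤-trans;
         m≤n⇒m<n∨m≡n; +-monoʳ-≤; +-cancelˡ-≡; m≤m+n; m+[n∸m]≡n; ∸-monoˡ-≤; module ≤-Reasoning)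
open import Data.Product using (Σ; ∃-syntax; _×_; _,_; proj₁; proj₂)
open import Data.Sum using (_⊎_; inj₁; inj₂)
open import Data.Vec using (tabulate)
open import Data.Vec.Properties using (lookup∘tabulate; []=⇒lookup; lookup⇒[]=)
open import Function.Bundles using (_⇔_; mk⇔; Equivalence)
open import Relation.Binary using (tri<; tri≈; tri>)
open import Relation.Binary.PropositionalEquality as ≡ using (_≡_; _≢_; refl; cong; subst)
open import Relation.Nullary using (¬_; Dec; yes; no)
open import Relation.Nullary.Decidable using (isYes; toWitness; fromWitness; decidable-stable; ¬?; _×-dec_)
open import Relation.Unary using (Decidable)

open Equivalence using (to; from)

⟦_⟧ : ∀ {k} {P : Fin k → Set} → Decidable P → Subset k
⟦ P? ⟧ = tabulate (λ w → isYes (P? w))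

∈⟦⟧⇔ : ∀ {k} {P : Fin k → Set} (P? : Decidable P) {w : Fin k} → w ∈ ⟦ P? ⟧ ⇔ P w
∈⟦⟧⇔ P? {w} = mk⇔
  (λ w∈ → toWitness {a? = P? w} (from T-≡ (≡.trans (≡.sym (lookup∘tabulate _ w)) ([]=⇒lookup w∈))))
  (λ Pw → lookup⇒[]= w _ (≡.trans (lookup∘tabulate _ w) (to T-≡ (fromWitness {a? = P? w} Pw))))

DownClosed UpClosed : ∀ {k} → (Fin k → Set) → Set
DownClosed P = ∀ {t t'} → toℕ t' ≤ toℕ t → P t → P t'
UpClosed   P = ∀ {t t'} → toℕ t ≤ toℕ t' → P t → P t'

predClosed⇒downClosed : ∀ {k} {P : Fin k → Set} →
  (∀ {t t'} → toℕ t' ≡ suc (toℕ t) → P t' → P t) → DownClosed P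
predClosed⇒downClosed one-down {zero}  {zero}   _        Pt = Pt
predClosed⇒downClosed one-down {suc zero} {zero} _ Pt = one-down {zero} {suc zero} refl Pt
predClosed⇒downClosed one-down {suc (suc t)} {zero} _ Pt =
  one-down {zero} {suc zero} refl (predClosed⇒downClosed (λ eq → one-down (cong suc eq)) {suc t} {zero} z≤n Pt)
predClosed⇒downClosed one-down {suc t} {suc t'} (s≤s le) Pt =
  predClosed⇒downClosed (λ eq → one-down (cong suc eq)) le Pt

succClosed⇒upClosed : ∀ {k} {P : Fin k → Set} →
  (∀ {t t'} → toℕ t' ≡ suc (toℕ t) → P t → P t') → UpClosed P
succClosed⇒upClosed one-up {zero}  {zero}   _        Pt = Pt
succClosed⇒upClosed one-up {zero} {suc zero} _ Pt = one-up {zero} {suc zero} refl Pt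
succClosed⇒upClosed one-up {zero} {suc (suc t')} _ Pt =
  succClosed⇒upClosed (λ eq → one-up (cong suc eq)) {zero} {suc t'} z≤n (one-up {zero} {suc zero} refl Pt)
succClosed⇒upClosed one-up {suc t} {suc t'} (s≤s le) Pt =
  succClosed⇒upClosed (λ eq → one-up (cong suc eq)) le Pt

downClosed⇒prefix : ∀ {k} {P : Fin k → Set} → Decidable P → DownClosed P →
  ∃[ j ] ∀ t → P t ⇔ toℕ t < j
downClosed⇒prefix {zero} P? closed = 0 , λ ()
downClosed⇒prefix {suc k} P? closed with P? zero
... | no ¬P0 = 0 , λ t → mk⇔ (λ Pt → ⊥-elim (¬P0 (closed z≤n Pt))) (λ ())
... | yes P0 with downClosed⇒prefix (λ t → P? (suc t)) (λ le → closed (s≤s le))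
...   | j , prefix = suc j , λ
  { zero    → mk⇔ (λ _ → s≤s z≤n) (λ _ → P0)
  ; (suc t) → mk⇔ (λ Pt → s≤s (to (prefix t) Pt)) (λ t<j → from (prefix t) (≤-pred t<j)) }

upClosed⇒suffix : ∀ {k} {P : Fin k → Set} → Decidable P → UpClosed P →
  ∃[ j ] ∀ t → P t ⇔ j ≤ toℕ t
upClosed⇒suffix P? closed
  with downClosed⇒prefix (λ t → ¬? (P? t)) (λ le ¬Pt Pt' → ¬Pt (closed le Pt'))
... | j , prefix = j , λ t → mk⇔
  (λ Pt → ≮⇒≥ (λ t<j → from (prefix t) t<j Pt))
  (λ j≤t → decidable-stable (P? t) (λ ¬Pt → <⇒≱ (to (prefix t) ¬Pt) j≤t))

least : ∀ {k} {P : Fin k → Set} → Decidable P → ∀ {p} → P p →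
  Σ (Fin k) λ i → P i × (∀ {q} → P q → toℕ i ≤ toℕ q)
least P? {zero} P0 = zero , P0 , λ _ → z≤n
least P? {suc p} Psp with P? zero
... | yes P0 = zero , P0 , λ _ → z≤n
... | no ¬P0 with least (λ q → P? (suc q)) Psp
...   | i , Psi , i≤ = suc i , Psi , λ { {zero} P0 → ⊥-elim (¬P0 P0) ; {suc q} Psq → s≤s (i≤ Psq) }

greatest : ∀ {k} {P : Fin k → Set} → Decidable P → ∀ {p} → P p →
  Σ (Fin k) λ j → P j × (∀ {q} → P q → toℕ q ≤ toℕ j)
greatest {suc k} {P} P? {p} Pp with any? (λ q → P? (suc q))
... | yes (q , Psq) with greatest (λ q → P? (suc q)) Psq
...   | j , Psj , ≤j = suc j , Psj , λ { {zero} _ → z≤n ; {suc q} Psq → s≤s (≤j Psq) }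
greatest {suc k} {P} P? {p} Pp | no ¬tail =
  zero , P-zero p Pp , λ { {zero} _ → z≤n ; {suc q} Psq → ⊥-elim (¬tail (q , Psq)) }
  where
  P-zero : ∀ q → P q → P zero
  P-zero zero    Pq  = Pq
  P-zero (suc q) Psq = ⊥-elim (¬tail (q , Psq))

Adj-sym : ∀ G {u v} → Adj G u v → Adj G v u
Adj-sym G {u} {v} = ≡.trans (Graph.sym G v u)

Adj? : ∀ G u v → Dec (Adj G u v)
Adj? G u v = adj G u v ≟ᵇ true

Reach⇒nbr : ∀ {G k} {b : Fin k → Vertex G} {p q} → Reach G b p q → q ≢ p → ∃[ r ] Adj G (b p) (b r)
Reach⇒nbr here q≢p = ⊥-elim (q≢p refl)
Reach⇒nbr {p = p} (step {j} {q} reach bj~bq) q≢p with j ≟ᶠ p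
... | yes refl = q , bj~bq
... | no j≢p = Reach⇒nbr reach j≢p

Between : ∀ {k N} → (Fin k → Fin N) → Fin k → Fin k → Fin N → Set
Between b a e w = ∃[ q ] (b q ≡ w × toℕ a ≤ toℕ q × toℕ q ≤ toℕ e)

block : ∀ {k N} → (Fin k → Fin N) → Fin k → Fin k → Subset N
block b a e = ⟦ (λ w → any? (λ q → (b q ≟ᶠ w) ×-dec ((toℕ a ≤? toℕ q) ×-dec (toℕ q ≤? toℕ e)))) ⟧

∈block⇔ : ∀ {k N} (b : Fin k → Fin N) a e {w} → w ∈ block b a e ⇔ Between b a e w
∈block⇔ b a e = ∈⟦⟧⇔ _

module Umbrella {G k} {b : Fin k → Vertex G} (umbrella : IsUmbrella G b) where

  nbr-left-downClosed : ∀ {r t t'} → toℕ r < toℕ t' → toℕ t' ≤ toℕ t →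
    Adj G (b r) (b t) → Adj G (b r) (b t')
  nbr-left-downClosed {r} {t} {t'} r<t' t'≤t br~bt with m≤n⇒m<n∨m≡n t'≤t
  ... | inj₁ t'<t = proj₁ (umbrella r t t' (<-≤-trans r<t' t'≤t) br~bt r<t' t'<t)
  ... | inj₂ t'≡t = subst (λ s → Adj G (b r) (b s)) (toℕ-injective (≡.sym t'≡t)) br~bt

  nbr-right-upClosed : ∀ {r t t'} → toℕ t ≤ toℕ t' → toℕ t' < toℕ r →
    Adj G (b t) (b r) → Adj G (b t') (b r)
  nbr-right-upClosed {r} {t} {t'} t≤t' t'<r bt~br with m≤n⇒m<n∨m≡n t≤t'
  ... | inj₁ t<t' = proj₂ (umbrella t r t' (≤-<-trans t≤t' t'<r) bt~br t<t' t'<r)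
  ... | inj₂ t≡t' = subst (λ s → Adj G (b s) (b r)) (toℕ-injective t≡t') bt~br

  edge⇒block-clique : ∀ {a e} → toℕ a < toℕ e → Adj G (b a) (b e) →
    ∀ {q q'} → toℕ a ≤ toℕ q → toℕ q < toℕ q' → toℕ q' ≤ toℕ e → Adj G (b q) (b q')
  edge⇒block-clique a<e ba~be a≤q q<q' q'≤e =
    nbr-left-downClosed q<q' q'≤e (nbr-right-upClosed a≤q (<-≤-trans q<q' q'≤e) ba~be)

edge-around : ∀ {G k} {b : Fin k → Vertex G} {p r} → Adj G (b p) (b r) →
  ∃[ a ] ∃[ e ] (toℕ a < toℕ e × Adj G (b a) (b e) × toℕ a ≤ toℕ p × toℕ p ≤ toℕ e)
edge-around {G} {b = b} {p} {r} bp~br with <-cmp (toℕ p) (toℕ r)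
... | tri< p<r _ _ = p , r , p<r , bp~br , ≤-refl , <⇒≤ p<r
... | tri≈ _ p≡r _ = ⊥-elim (irrefl G (b p) (subst (λ s → Adj G (b p) (b s)) (≡.sym (toℕ-injective p≡r)) bp~br))
... | tri> _ _ r<p = r , p , r<p , Adj-sym G bp~br , <⇒≤ r<p , ≤-refl

module BlockEnumeration {k} {a e : Fin k} (a≤e : toℕ a ≤ toℕ e) where

  width : ℕ
  width = suc (toℕ e ∸ toℕ a)

  offset≤ : (t : Fin width) → toℕ a + toℕ t ≤ toℕ e
  offset≤ t = begin
    toℕ a + toℕ t            ≤⟨ +-monoʳ-≤ (toℕ a) (toℕ≤pred[n] t) ⟩
    toℕ a + (toℕ e ∸ toℕ a) ≡⟨ m+[n∸m]≡n a≤e ⟩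
    toℕ e                    ∎
    where open ≤-Reasoning

  pos : Fin width → Fin k
  pos t = fromℕ< (≤-<-trans (offset≤ t) (toℕ<n e))

  toℕ-pos : ∀ t → toℕ (pos t) ≡ toℕ a + toℕ t
  toℕ-pos t = toℕ-fromℕ< _

  a≤pos : ∀ t → toℕ a ≤ toℕ (pos t)
  a≤pos t rewrite toℕ-pos t = m≤m+n (toℕ a) (toℕ t)

  pos≤e : ∀ t → toℕ (pos t) ≤ toℕ e
  pos≤e t rewrite toℕ-pos t = offset≤ t

  pos-mono : ∀ {t t'} → toℕ t ≤ toℕ t' → toℕ (pos t) ≤ toℕ (pos t')
  pos-mono {t} {t'} t≤t' rewrite toℕ-pos t | toℕ-pos t' = +-monoʳ-≤ (toℕ a) t≤t'

  pos-injective : ∀ {t t'} → pos t ≡ pos t' → t ≡ t'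
  pos-injective {t} {t'} pos-t≡pos-t' = toℕ-injective (+-cancelˡ-≡ (toℕ a) _ _ (begin
    toℕ a + toℕ t   ≡⟨ ≡.sym (toℕ-pos t) ⟩
    toℕ (pos t)     ≡⟨ cong toℕ pos-t≡pos-t' ⟩
    toℕ (pos t')    ≡⟨ toℕ-pos t' ⟩
    toℕ a + toℕ t'  ∎))
    where open ≡.≡-Reasoning

  pos-onto : ∀ {q} → toℕ a ≤ toℕ q → toℕ q ≤ toℕ e → ∃[ t ] pos t ≡ q
  pos-onto {q} a≤q q≤e = t , toℕ-injective (begin
    toℕ (pos t)                ≡⟨ toℕ-pos t ⟩
    toℕ a + toℕ t              ≡⟨ cong (toℕ a +_) (toℕ-fromℕ< q-a<width) ⟩
    toℕ a + (toℕ q ∸ toℕ a)   ≡⟨ m+[n∸m]≡n a≤q ⟩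
    toℕ q                      ∎)
    where
    open ≡.≡-Reasoning
    q-a<width : toℕ q ∸ toℕ a < width
    q-a<width = s≤s (∸-monoˡ-≤ (toℕ a) q≤e)
    t : Fin width
    t = fromℕ< q-a<width

module _ {G m b} (T : TwoBranch G m b) where
  open Umbrella {G} {b = b} (umbrella T)

  L-nbrs-downClosed : ∀ {v} → lab T v ≡ inL → DownClosed (λ q → Adj G (b q) v)
  L-nbrs-downClosed {v} v∈L = predClosed⇒downClosed one-down
    where
    one-down : ∀ {q q'} → toℕ q' ≡ suc (toℕ q) → Adj G (b q') v → Adj G (b q) v
    one-down {q} {q'} q'≡1+q bq'~v with toℕ q' ≤? toℕ (ll' T)
    ... | yes q'≤l' = nestL T q q' q'≡1+q q'≤l' v v∈L bq'~v
    ... | no q'≰l'  = ⊥-elim (noL T q' v (≰⇒> q'≰l') v∈L bq'~v)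

  R-nbrs-upClosed : ∀ {v} → lab T v ≡ inR → UpClosed (λ q → Adj G (b q) v)
  R-nbrs-upClosed {v} v∈R = succClosed⇒upClosed one-up
    where
    one-up : ∀ {q q'} → toℕ q' ≡ suc (toℕ q) → Adj G (b q) v → Adj G (b q') v
    one-up {q} {q'} q'≡1+q bq~v with toℕ (ll T) ≤? toℕ q
    ... | yes l≤q = nestR T q q' q'≡1+q l≤q v v∈R bq~v
    ... | no l≰q  = ⊥-elim (noR T q v (≰⇒> l≰q) v∈R bq~v)

  BR-nbr∈B : ∀ {p v} → InBR T p → Adj G (b p) v → ∃[ q ] b q ≡ v
  BR-nbr∈B {p} {v} p∈BR bp~v with lab T v in v∈
  ... | inB = to (labB T v) v∈
  ... | inL = ⊥-elim (noL T p v (proj₁ p∈BR) v∈ bp~v)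
  ... | inR = ⊥-elim (noR T p v (proj₂ p∈BR) v∈ bp~v)
  ... | inC = ⊥-elim (noBC T p v v∈ bp~v)

  BR-has-nbr : ∀ {p} → InBR T p → ∃[ r ] Adj G (b p) (b r)
  BR-has-nbr p∈BR = Reach⇒nbr (connected T _ (ll' T)) (λ l'≡p → <-irrefl (cong toℕ l'≡p) (proj₁ p∈BR))

  clique-through-BR⊆B : ∀ {S p} → IsClique G S → InBR T p → b p ∈ S → ∀ {w} → w ∈ S → ∃[ q ] b q ≡ w
  clique-through-BR⊆B {p = p} S-clique p∈BR bp∈S {w} w∈S with w ≟ᶠ b p
  ... | yes refl = p , refl
  ... | no w≢bp  = BR-nbr∈B p∈BR (S-clique (b p) w bp∈S w∈S (λ bp≡w → w≢bp (≡.sym bp≡w)))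

  module _ {a e} (a<e : toℕ a < toℕ e) (ba~be : Adj G (b a) (b e)) where
    open BlockEnumeration (<⇒≤ a<e)

    enum : Fin width → Vertex G
    enum t = b (pos t)

    block-clique : IsClique G (block b a e)
    block-clique u v u∈ v∈ u≢v with to (∈block⇔ b a e) u∈ | to (∈block⇔ b a e) v∈
    ... | q , refl , a≤q , q≤e | q' , refl , a≤q' , q'≤e with <-cmp (toℕ q) (toℕ q')
    ...   | tri< q<q' _ _ = edge⇒block-clique a<e ba~be a≤q q<q' q'≤e
    ...   | tri≈ _ q≡q' _ = ⊥-elim (u≢v (cong b (toℕ-injective q≡q')))
    ...   | tri> _ _ q'<q = Adj-sym G (edge⇒block-clique a<e ba~be a≤q' q'<q q≤e)

    outside-nbrs-closed : ∀ {v} → v ∉ block b a e →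
      DownClosed (λ t → Adj G v (enum t)) ⊎ UpClosed (λ t → Adj G v (enum t))
    outside-nbrs-closed {v} v∉ with lab T v in v∈
    ... | inC = inj₁ λ _ v~et → ⊥-elim (noBC T _ v v∈ (Adj-sym G v~et))
    ... | inL = inj₁ λ t'≤t v~et → Adj-sym G (L-nbrs-downClosed v∈ (pos-mono t'≤t) (Adj-sym G v~et))
    ... | inR = inj₂ λ t≤t' v~et → Adj-sym G (R-nbrs-upClosed v∈ (pos-mono t≤t') (Adj-sym G v~et))
    ... | inB with to (labB T v) v∈
    ...   | r , refl with toℕ r <? toℕ a
    ...     | yes r<a = inj₁ λ t'≤t → nbr-left-downClosed (<-≤-trans r<a (a≤pos _)) (pos-mono t'≤t)
    ...     | no r≮a with toℕ r ≤? toℕ e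
    ...       | yes r≤e = ⊥-elim (v∉ (from (∈block⇔ b a e) (r , refl , ≮⇒≥ r≮a , r≤e)))
    ...       | no r≰e  = inj₂ λ t≤t' br~et → Adj-sym G
                  (nbr-right-upClosed (pos-mono t≤t') (≤-<-trans (pos≤e _) (≰⇒> r≰e)) (Adj-sym G br~et))

    edge⇒block-isKJoin : IsKJoin G (block b a e)
    edge⇒block-isKJoin = block-clique , width , enum , (λ eq → pos-injective (inj T eq)) , enum-image , shape
      where
      enum-image : ∀ v → v ∈ block b a e ⇔ (∃[ t ] enum t ≡ v)
      enum-image v = mk⇔
        (λ v∈ → let q , bq≡v , a≤q , q≤e = to (∈block⇔ b a e) v∈
                    t , pos-t≡q = pos-onto a≤q q≤e
                in t , ≡.trans (cong b pos-t≡q) bq≡v)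
        (λ (t , et≡v) → from (∈block⇔ b a e) (pos t , et≡v , a≤pos t , pos≤e t))
      shape : ∀ v → v ∉ block b a e →
        (∀ t → ¬ Adj G v (enum t))
        ⊎ (∃[ j ] ∀ t → Adj G v (enum t) ⇔ toℕ t < j)
        ⊎ (∃[ j ] ∀ t → Adj G v (enum t) ⇔ j ≤ toℕ t)
      shape v v∉ with outside-nbrs-closed v∉
      ... | inj₁ down = inj₂ (inj₁ (downClosed⇒prefix (λ t → Adj? G v (enum t)) down))
      ... | inj₂ up   = inj₂ (inj₂ (upClosed⇒suffix (λ t → Adj? G v (enum t)) up))

module MaximalKJoinInBranch {G m b} (T : TwoBranch G m b) {S : Subset (n G)} (S-max : IsMaximalKJoin G S)
  (S⊆B : ∀ {w} → w ∈ S → ∃[ q ] b q ≡ w) {p r : Fin (suc m)} (bp∈S : b p ∈ S) (bp~br : Adj G (b p) (b r))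
  where

  private
    InS? : Decidable (λ q → b q ∈ S)
    InS? q = b q ∈? S

  i j : Fin (suc m)
  i = proj₁ (least InS? bp∈S)
  j = proj₁ (greatest InS? bp∈S)

  bi∈S : b i ∈ S
  bi∈S = proj₁ (proj₂ (least InS? bp∈S))

  bj∈S : b j ∈ S
  bj∈S = proj₁ (proj₂ (greatest InS? bp∈S))

  i-least : ∀ {q} → b q ∈ S → toℕ i ≤ toℕ q
  i-least = proj₂ (proj₂ (least InS? bp∈S))

  j-greatest : ∀ {q} → b q ∈ S → toℕ q ≤ toℕ j
  j-greatest = proj₂ (proj₂ (greatest InS? bp∈S))

  S⊆[i,j] : ∀ {w} → w ∈ S → Between b i j w
  S⊆[i,j] w∈S with S⊆B w∈S
  ... | q , refl = q , refl , i-least w∈S , j-greatest w∈S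

  enclosing-block⊆S : ∀ {a e} → toℕ a < toℕ e → Adj G (b a) (b e) →
    toℕ a ≤ toℕ i → toℕ j ≤ toℕ e → block b a e ⊆ S
  enclosing-block⊆S {a} {e} a<e ba~be a≤i j≤e =
    proj₂ S-max (block b a e) (edge⇒block-isKJoin T a<e ba~be) S⊆block
    where
    S⊆block : S ⊆ block b a e
    S⊆block w∈S = let q , bq≡w , i≤q , q≤j = S⊆[i,j] w∈S
                  in from (∈block⇔ b a e) (q , bq≡w , ≤-trans a≤i i≤q , ≤-trans q≤j j≤e)

  enclosing-edge≡ij : ∀ {a e} → toℕ a < toℕ e → Adj G (b a) (b e) →
    toℕ a ≤ toℕ i → toℕ j ≤ toℕ e → a ≡ i × e ≡ j
  enclosing-edge≡ij {a} {e} a<e ba~be a≤i j≤e =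
    toℕ-injective (≤-antisym a≤i (i-least (block⊆S (a , refl , ≤-refl , <⇒≤ a<e)))) ,
    toℕ-injective (≤-antisym (j-greatest (block⊆S (e , refl , <⇒≤ a<e , ≤-refl))) j≤e)
    where
    block⊆S : ∀ {w} → Between b a e w → w ∈ S
    block⊆S w∈ = enclosing-block⊆S a<e ba~be a≤i j≤e (from (∈block⇔ b a e) w∈)

  -- If i = j then S = {b p}, and the block of an edge at b p would be a larger K-join.
  i<j : toℕ i < toℕ j
  i<j with m≤n⇒m<n∨m≡n (≤-trans (i-least bp∈S) (j-greatest bp∈S)) | edge-around {G} {b = b} bp~br
  ... | inj₁ i<j  | _ = i<j
  ... | inj₂ i≡j  | a , e , a<e , ba~be , a≤p , p≤e
    with enclosing-edge≡ij a<e ba~be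
           (≤-trans a≤p (subst (toℕ p ≤_) (≡.sym i≡j) (j-greatest bp∈S)))
           (≤-trans (subst (_≤ toℕ p) i≡j (i-least bp∈S)) p≤e)
  ...   | refl , refl = a<e

  bi~bj : Adj G (b i) (b j)
  bi~bj = proj₁ (proj₁ S-max) (b i) (b j) bi∈S bj∈S (λ bi≡bj → <-irrefl (cong toℕ (inj T bi≡bj)) i<j)

  ij-extremal : IsExtremal G b i j
  ij-extremal = i<j , bi~bj , λ _ _ a<e ba~be a≤i j≤e → enclosing-edge≡ij a<e ba~be a≤i j≤e

  S≡block : ∀ w → w ∈ S ⇔ Between b i j w
  S≡block w = mk⇔ S⊆[i,j] (λ w∈ → enclosing-block⊆S i<j bi~bj ≤-refl ≤-refl (from (∈block⇔ b i j) w∈))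

lemma11 : (G : Graph) (m : ℕ) (b : Fin (suc m) → Vertex G) (T : TwoBranch G m b)
    (p : Fin (suc m)) → InBR T p →
    (S : Subset (n G)) → IsMaximalKJoin G S → b p ∈ S →
    Σ (Fin (suc m)) λ i → Σ (Fin (suc m)) λ j → IsExtremal G b i j ×
      (∀ w → w ∈ S ⇔ (∃[ q ] (b q ≡ w × toℕ i ≤ toℕ q × toℕ q ≤ toℕ j)))
lemma11 G m b T p p∈BR S S-max bp∈S = i , j , ij-extremal , S≡block
  where
  open MaximalKJoinInBranch T S-max (clique-through-BR⊆B T (proj₁ (proj₁ S-max)) p∈BR bp∈S)
         bp∈S (proj₂ (BR-has-nbr T p∈BR))
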